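{- Let $\rho$ be an integer polymatroid on $E=[n]$. For $A\subseteq E$ and $i\in A$, we have $\rho(A)<\rho(A-\{i\})+\rho(\{i\})$ if and only if there is a circuit $\mathbf{u}$ of $\rho$ with $u_i>0$ and $u_j=0$ for all $j\in E-A$.
   Context: An integer polymatroid on $E=[n]$ is a function $\rho:2^E\to\mathbb{N}$ with $\rho(\emptyset)=0$, monotone and submodular. For $\mathbf{u}\in\mathbb{N}^n$ and $X\subseteq E$, $|\mathbf{u}|_X=\sum_{i\in X}u_i$; $\mathbf{u}$ is independent if $|\mathbf{u}|_X\le\rho(X)$ for all $X$. With $[m]_0=\{0,\ldots,m\}$ and $\mathbf{U}=\prod_{i=1}^n[\rho(\{i\})]_0$, a circuit of $\rho$ is a vector $\mathbf{u}\in\mathbf{U}$ that is not independent but every $\mathbf{w}\in\mathbb{N}^n$ with $\mathbf{w}\le\mathbf{u}$ componentwise and $\mathbf{w}\ne\mathbf{u}$ is independent. -}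

module Defs where

open import Data.Nat using (ℕ; zero; suc; _+_; _≤_; _<_)
open import Data.Bool using (Bool; true; false)
open import Data.Fin using (Fin)
import Data.Fin as F
open import Data.Fin.Subset using (Subset; ⊥; _∪_; _∩_; _⊆_; _∈_; _∉_; ⁅_⁆; _-_)
open import Data.Vec using (Vec; []; _∷_)
open import Data.Product using (_×_; Σ)
open import Relation.Binary.PropositionalEquality using (_≡_)
open import Relation.Nullary using (¬_)

∣_∣ₛ_ : ∀ {n} → (Fin n → ℕ) → Subset n → ℕ
∣_∣ₛ_ {zero} u [] = 0
∣_∣ₛ_ {suc n} u (true ∷ X) = u F.zero + ∣ (λ i → u (F.suc i)) ∣ₛ X
∣_∣ₛ_ {suc n} u (false ∷ X) = ∣ (λ i → u (F.suc i)) ∣ₛ X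

record IsIntPolymatroid {n : ℕ} (ρ : Subset n → ℕ) : Set where
  field
    normalized : ρ ⊥ ≡ 0
    monotone   : ∀ X Y → X ⊆ Y → ρ X ≤ ρ Y
    submodular : ∀ X Y → ρ (X ∪ Y) + ρ (X ∩ Y) ≤ ρ X + ρ Y

_≤ᵥ_ : ∀ {n} → (Fin n → ℕ) → (Fin n → ℕ) → Set
w ≤ᵥ u = ∀ i → w i ≤ u i

Independent : ∀ {n} → (Subset n → ℕ) → (Fin n → ℕ) → Set
Independent ρ u = ∀ X → ∣ u ∣ₛ X ≤ ρ X

InBox : ∀ {n} → (Subset n → ℕ) → (Fin n → ℕ) → Set
InBox ρ u = ∀ i → u i ≤ ρ ⁅ i ⁆

-- w ≠ u as functions Fin n → ℕ (pointwise: some coordinate differs)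
IsCircuit : ∀ {n} → (Subset n → ℕ) → (Fin n → ℕ) → Set
IsCircuit ρ u =
  InBox ρ u × ¬ Independent ρ u ×
  (∀ w → w ≤ᵥ u → ¬ (∀ i → w i ≡ u i) → Independent ρ w)

-- Greedily taking the rank increments along a chain gives an independent b supported
-- on A - i with |b|_{A-i} = ρ(A - i). If ρ(A) < ρ(A - i) + ρ({i}), raising b_i to
-- ρ({i}) gives a dependent vector of the box; any minimally dependent vector below it
-- is a circuit supported in A, and it uses i because otherwise it would lie below b.
-- Conversely, if ρ(A) = ρ(A - i) + ρ({i}), submodularity gives
-- ρ(Y) = ρ(Y - i) + ρ({i}) for every Y ⊆ A containing i, so a vector supported in A
-- with u_i ≤ ρ({i}) is independent once it is independent after zeroing u_i; for a
-- circuit with u_i > 0 the latter holds by minimality, which is a contradiction.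
module Submission where

open import Defs
open import Data.Nat using (ℕ; _+_; _<_)
open import Data.Fin using (Fin)
open import Data.Fin.Subset using (Subset; _∈_; _∉_; ⁅_⁆; _-_)
open import Data.Product using (_×_; Σ)
open import Function.Bundles using (_⇔_)
open import Relation.Binary.PropositionalEquality using (_≡_)

open import Data.Bool using (true; false)
open import Data.Fin using (zero; suc; _≟_)
open import Data.Fin.Properties using (any?; ¬∀⟶∃¬)
open import Data.Fin.Subset using (_∪_; _∩_; _─_; _⊆_; ⊤; outside)
open import Data.Fin.Subset.Properties
  using (_∈?_; ⊆-refl; ⊆-antisym; out⊆; s⊆s; p─⊥≡p; p─q⊆p; anySubset?; x∈p∧x≢y⇒x∈p-y;
         p∩q⊆p; p∩q⊆q; drop-there; x∈p∩q⁺; x∈p∩q⁻; x∈p∪q⁺; x∈p∪q⁻; x∈⁅x⁆; ∈⊤)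
open import Data.Nat using (zero; suc; pred; _∸_; _≤_; z≤n; _<?_; _≤?_)
open import Data.Nat.Induction using (<-wellFounded)
open import Data.Nat.Properties
  using (≤-refl; ≤-trans; ≤-reflexive; <-irrefl; <⇒≱; +-mono-≤; +-monoʳ-≤;
         +-monoˡ-<; +-comm; +-cancelˡ-≤; +-∸-comm; m≤n+o⇒m∸n≤o; pred[n]≤n;
         <⇒≤pred; ≤∧≢⇒<; ≤-<-trans; m≤m+n; n≢0⇒n>0; n≤0⇒n≡0; ≮⇒≥; n∸n≡0; m∸n+n≡m; +-commutativeSemigroup; module ≤-Reasoning)
  renaming (_≟_ to _≟ℕ_)
open import Algebra.Properties.CommutativeSemigroup +-commutativeSemigroup using (x∙yz≈y∙xz)
open import Data.Product using (∃; _,_; proj₁; proj₂)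
open import Data.Sum using (inj₁; inj₂; [_,_]′)
open import Data.Vec using ([]; _∷_; here; there)
open import Data.Vec.Functional using (updateAt)
open import Data.Vec.Functional.Properties using (updateAt-updates; updateAt-minimal)
open import Function using (_∘_; id; const; case_of_)
open import Function.Bundles using (mk⇔)
open import Induction.WellFounded using (Acc; acc)
open import Relation.Binary.PropositionalEquality using (refl; sym; trans; cong; cong₂; subst; subst₂; _≢_)
open import Relation.Nullary using (¬_; Dec; yes; no; contradiction)
open import Relation.Nullary.Decidable using (_×-dec_; ¬?; decidable-stable)

private variable
  n : ℕ

x∈p─q⇒x∉q : ∀ {x : Fin n} (p q : Subset n) → x ∈ p ─ q → x ∉ q
x∈p─q⇒x∉q (_ ∷ p) (true ∷ q) (there x∈) (there x∈q) = x∈p─q⇒x∉q p q x∈ x∈q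
x∈p─q⇒x∉q (_ ∷ p) (false ∷ q) (there x∈) (there x∈q) = x∈p─q⇒x∉q p q x∈ x∈q

x∈p-y⇒x≢y : ∀ {x y : Fin n} (p : Subset n) → x ∈ p - y → x ≢ y
x∈p-y⇒x≢y {y = y} p x∈ refl = x∈p─q⇒x∉q p ⁅ y ⁆ x∈ (x∈⁅x⁆ y)

x∈p-y⇒x∈p : ∀ {x y : Fin n} (p : Subset n) → x ∈ p - y → x ∈ p
x∈p-y⇒x∈p {y = y} p = p─q⊆p p ⁅ y ⁆

p⊆q⇒p∪q≡q : ∀ {p q : Subset n} → p ⊆ q → p ∪ q ≡ q
p⊆q⇒p∪q≡q {p = p} {q} p⊆q =
  ⊆-antisym (λ x∈ → [ p⊆q , id ]′ (x∈p∪q⁻ p q x∈)) (λ x∈q → x∈p∪q⁺ (inj₂ x∈q))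

p⊆q⇒p∩q≡p : ∀ {p q : Subset n} → p ⊆ q → p ∩ q ≡ p
p⊆q⇒p∩q≡p {p = p} {q} p⊆q = ⊆-antisym (p∩q⊆p p q) (λ x∈p → x∈p∩q⁺ (x∈p , p⊆q x∈p))

sum-cong : ∀ {u w : Fin n → ℕ} X → (∀ j → j ∈ X → u j ≡ w j) → ∣ u ∣ₛ X ≡ ∣ w ∣ₛ X
sum-cong [] _ = refl
sum-cong (true ∷ X) u≡w = cong₂ _+_ (u≡w zero here) (sum-cong X (λ j → u≡w (suc j) ∘ there))
sum-cong (false ∷ X) u≡w = sum-cong X (λ j → u≡w (suc j) ∘ there)

sum-mono : ∀ {u w : Fin n → ℕ} X → u ≤ᵥ w → ∣ u ∣ₛ X ≤ ∣ w ∣ₛ X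
sum-mono [] _ = z≤n
sum-mono (true ∷ X) u≤w = +-mono-≤ (u≤w zero) (sum-mono X (u≤w ∘ suc))
sum-mono (false ∷ X) u≤w = sum-mono X (u≤w ∘ suc)

sum-remove : ∀ (u : Fin n → ℕ) X {i} → i ∈ X → ∣ u ∣ₛ X ≡ u i + ∣ u ∣ₛ (X - i)
sum-remove u (true ∷ X) here = cong (u zero +_) (cong (∣ u ∘ suc ∣ₛ_) (sym (p─⊥≡p X)))
sum-remove u (true ∷ X) {suc i} (there i∈X) =
  trans (cong (u zero +_) (sum-remove (u ∘ suc) X i∈X)) (x∙yz≈y∙xz (u zero) (u (suc i)) _)
sum-remove u (false ∷ X) (there i∈X) = sum-remove (u ∘ suc) X i∈X

sum-restrict : ∀ {u : Fin n → ℕ} X Y → (∀ j → j ∉ Y → u j ≡ 0) → ∣ u ∣ₛ X ≡ ∣ u ∣ₛ (X ∩ Y)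
sum-restrict [] [] _ = refl
sum-restrict (true ∷ X) (true ∷ Y) u≡0 =
  cong (_ +_) (sum-restrict X Y (λ j j∉Y → u≡0 (suc j) (j∉Y ∘ drop-there)))
sum-restrict (true ∷ X) (false ∷ Y) u≡0 =
  cong₂ _+_ (u≡0 zero λ ()) (sum-restrict X Y (λ j j∉Y → u≡0 (suc j) (j∉Y ∘ drop-there)))
sum-restrict (false ∷ X) (_ ∷ Y) u≡0 = sum-restrict X Y (λ j j∉Y → u≡0 (suc j) (j∉Y ∘ drop-there))

coordinate≤sum : ∀ (u : Fin n → ℕ) X {i} → i ∈ X → u i ≤ ∣ u ∣ₛ X
coordinate≤sum u X i∈X = subst (u _ ≤_) (sym (sum-remove u X i∈X)) (m≤m+n _ _)

updateAt-elim : ∀ (P : Fin n → ℕ → Set) (v : Fin n → ℕ) i {f : ℕ → ℕ} →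
                P i (f (v i)) → (∀ j → j ≢ i → P j (v j)) → ∀ j → P j (updateAt v i f j)
updateAt-elim P v i Pi Pj j with j ≟ i
... | yes refl = subst (P j) (sym (updateAt-updates j v)) Pi
... | no j≢i = subst (P j) (sym (updateAt-minimal j i v j≢i)) (Pj j j≢i)

sum-updateAt-∈ : ∀ (v : Fin n → ℕ) X {i f} → i ∈ X → ∣ updateAt v i f ∣ₛ X ≡ f (v i) + ∣ v ∣ₛ (X - i)
sum-updateAt-∈ v X {i} i∈X =
  trans (sum-remove _ X i∈X)
        (cong₂ _+_ (updateAt-updates i v)
                   (sum-cong (X - i) (λ j j∈ → updateAt-minimal j i v (x∈p-y⇒x≢y X j∈))))

sum-updateAt-∉ : ∀ (v : Fin n → ℕ) X {i f} → i ∉ X → ∣ updateAt v i f ∣ₛ X ≡ ∣ v ∣ₛ X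
sum-updateAt-∉ v X {i} i∉X =
  sum-cong X (λ j j∈X → updateAt-minimal j i v (λ { refl → i∉X j∈X }))

independent? : ∀ (ρ : Subset n → ℕ) u → Dec (Independent ρ u)
independent? ρ u with anySubset? (λ X → ¬? (∣ u ∣ₛ X ≤? ρ X))
... | yes (X , ≰) = no λ ind → ≰ (ind X)
... | no ∄ = yes λ X → decidable-stable (∣ u ∣ₛ X ≤? ρ X) (λ ≰ → ∄ (X , ≰))

independent-antitone : ∀ {ρ : Subset n → ℕ} {u w} → w ≤ᵥ u → Independent ρ u → Independent ρ w
independent-antitone w≤u ind X = ≤-trans (sum-mono X w≤u) (ind X)

independent⇒inBox : ∀ {ρ : Subset n → ℕ} {u} → Independent ρ u → InBox ρ u
independent⇒inBox {u = u} ind j = ≤-trans (coordinate≤sum u ⁅ j ⁆ (x∈⁅x⁆ j)) (ind ⁅ j ⁆)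

MinimallyDependent : (Subset n → ℕ) → (Fin n → ℕ) → Set
MinimallyDependent ρ u =
  ¬ Independent ρ u × (∀ w → w ≤ᵥ u → ¬ (∀ i → w i ≡ u i) → Independent ρ w)

decrementAt : (Fin n → ℕ) → Fin n → Fin n → ℕ
decrementAt v j = updateAt v j pred

decrementAt-≤ᵥ : ∀ (v : Fin n → ℕ) j → decrementAt v j ≤ᵥ v
decrementAt-≤ᵥ v j = updateAt-elim (λ k x → x ≤ v k) v j pred[n]≤n (λ _ _ → ≤-refl)

≤ᵥ-decrementAt : ∀ {v w : Fin n → ℕ} {j} → w ≤ᵥ v → w j ≢ v j → w ≤ᵥ decrementAt v j
≤ᵥ-decrementAt {v = v} {w} {j} w≤v wj≢vj =
  updateAt-elim (λ k x → w k ≤ x) v j (<⇒≤pred (≤∧≢⇒< (w≤v j) wj≢vj)) (λ k _ → w≤v k)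

decrementAt-shrinks : ∀ {v : Fin n → ℕ} {j} → 0 < v j → ∣ decrementAt v j ∣ₛ ⊤ < ∣ v ∣ₛ ⊤
decrementAt-shrinks {v = v} {j} 0<vj = begin-strict
  ∣ decrementAt v j ∣ₛ ⊤       ≡⟨ sum-updateAt-∈ v ⊤ ∈⊤ ⟩
  pred (v j) + ∣ v ∣ₛ (⊤ - j)  <⟨ +-monoˡ-< _ (pred[n]<n 0<vj) ⟩
  v j + ∣ v ∣ₛ (⊤ - j)         ≡⟨ sym (sum-remove v ⊤ ∈⊤) ⟩
  ∣ v ∣ₛ ⊤                     ∎
  where
  open ≤-Reasoning
  pred[n]<n : ∀ {m} → 0 < m → pred m < m
  pred[n]<n {suc _} _ = ≤-refl

module _ (ρ : Subset n → ℕ) where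

  minimallyDependent-if-decrements-independent :
    ∀ {v} → (∀ j → 0 < v j → Independent ρ (decrementAt v j)) → ¬ Independent ρ v →
    MinimallyDependent ρ v
  minimallyDependent-if-decrements-independent {v} decrement-ind dep = dep , minimal
    where
    minimal : ∀ w → w ≤ᵥ v → ¬ (∀ i → w i ≡ v i) → Independent ρ w
    minimal w w≤v w≢v with ¬∀⟶∃¬ _ _ (λ j → w j ≟ℕ v j) w≢v
    ... | j , wj≢vj = independent-antitone (≤ᵥ-decrementAt w≤v wj≢vj)
                        (decrement-ind j (≤-<-trans z≤n (≤∧≢⇒< (w≤v j) wj≢vj)))

  dependent⇒minimallyDependent-below :
    ∀ v → ¬ Independent ρ v → ∃ λ u → u ≤ᵥ v × MinimallyDependent ρ u
  dependent⇒minimallyDependent-below v = descend v (<-wellFounded _)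
    where
    descend : ∀ v → Acc _<_ (∣ v ∣ₛ ⊤) → ¬ Independent ρ v →
              ∃ λ u → u ≤ᵥ v × MinimallyDependent ρ u
    descend v (acc smaller) dep
      with any? (λ j → (0 <? v j) ×-dec ¬? (independent? ρ (decrementAt v j)))
    ... | yes (j , 0<vj , dep′) =
      let u , u≤ , minDep = descend (decrementAt v j) (smaller (decrementAt-shrinks {v = v} 0<vj)) dep′
      in u , (λ k → ≤-trans (u≤ k) (decrementAt-≤ᵥ v j k)) , minDep
    ... | no ∄ = v , (λ _ → ≤-refl) , minimallyDependent-if-decrements-independent
                   (λ j 0<vj → decidable-stable (independent? ρ _) (λ dep′ → ∄ (j , 0<vj , dep′))) dep

open IsIntPolymatroid

restrictTail : (Subset (suc n) → ℕ) → Subset n → ℕ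
restrictTail ρ Y = ρ (outside ∷ Y)

restrictTail-isIntPolymatroid : ∀ {ρ : Subset (suc n) → ℕ} →
                                IsIntPolymatroid ρ → IsIntPolymatroid (restrictTail ρ)
restrictTail-isIntPolymatroid pm = record
  { normalized = normalized pm
  ; monotone   = λ X Y X⊆Y → monotone pm _ _ (s⊆s X⊆Y)
  ; submodular = λ X Y → submodular pm (outside ∷ X) (outside ∷ Y)
  }

-- b_j = ρ(B ∩ {j,…,n-1}) ∸ ρ(B ∩ {j+1,…,n-1}): the rank increments of B along the
-- chain of its tails.
greedy : (Subset n → ℕ) → Subset n → Fin n → ℕ
greedy ρ (x ∷ B) zero    = ρ (x ∷ B) ∸ ρ (outside ∷ B)
greedy ρ (_ ∷ B) (suc j) = greedy (restrictTail ρ) B j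

greedy-outside : ∀ (ρ : Subset n → ℕ) B {j} → j ∉ B → greedy ρ B j ≡ 0
greedy-outside ρ (true ∷ B) {zero} j∉B = contradiction here j∉B
greedy-outside ρ (false ∷ B) {zero} _ = n∸n≡0 (ρ (outside ∷ B))
greedy-outside ρ (_ ∷ B) {suc j} j∉B = greedy-outside (restrictTail ρ) B (j∉B ∘ there)

greedy-sum : ∀ {ρ : Subset n → ℕ} → IsIntPolymatroid ρ → ∀ B → ∣ greedy ρ B ∣ₛ B ≡ ρ B
greedy-sum pm [] = sym (normalized pm)
greedy-sum {ρ = ρ} pm (true ∷ B) =
  trans (cong (ρ (true ∷ B) ∸ ρ (outside ∷ B) +_) (greedy-sum (restrictTail-isIntPolymatroid pm) B))
        (m∸n+n≡m (monotone pm _ _ (out⊆ ⊆-refl)))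
greedy-sum pm (false ∷ B) = greedy-sum (restrictTail-isIntPolymatroid pm) B

greedy-bounded : ∀ {ρ : Subset n → ℕ} → IsIntPolymatroid ρ → ∀ B X → ∣ greedy ρ B ∣ₛ X ≤ ρ (X ∩ B)
greedy-bounded pm [] [] = z≤n
greedy-bounded pm (_ ∷ B) (false ∷ X) = greedy-bounded (restrictTail-isIntPolymatroid pm) B X
greedy-bounded {ρ = ρ} pm (false ∷ B) (true ∷ X) =
  subst (λ b₀ → b₀ + ∣ greedy (restrictTail ρ) B ∣ₛ X ≤ ρ (outside ∷ X ∩ B)) (sym (n∸n≡0 (ρ (outside ∷ B))))
        (greedy-bounded (restrictTail-isIntPolymatroid pm) B X)
greedy-bounded {ρ = ρ} pm (true ∷ B) (true ∷ X) = begin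
  (ρ (true ∷ B) ∸ ρ (false ∷ B)) + ∣ greedy (restrictTail ρ) B ∣ₛ X
    ≡⟨ sym (+-∸-comm (∣ greedy (restrictTail ρ) B ∣ₛ X) (monotone pm _ _ (out⊆ ⊆-refl))) ⟩
  (ρ (true ∷ B) + ∣ greedy (restrictTail ρ) B ∣ₛ X) ∸ ρ (false ∷ B)
    ≤⟨ m≤n+o⇒m∸n≤o (ρ (true ∷ B) + ∣ greedy (restrictTail ρ) B ∣ₛ X) (ρ (false ∷ B)) (begin
         ρ (true ∷ B) + ∣ greedy (restrictTail ρ) B ∣ₛ X
           ≤⟨ +-monoʳ-≤ (ρ (true ∷ B)) (greedy-bounded (restrictTail-isIntPolymatroid pm) B X) ⟩
         ρ (true ∷ B) + ρ (false ∷ Z)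
           ≤⟨ submodular-exchange ⟩
         ρ (true ∷ Z) + ρ (false ∷ B)
           ≡⟨ +-comm (ρ (true ∷ Z)) (ρ (false ∷ B)) ⟩
         ρ (false ∷ B) + ρ (true ∷ Z) ∎) ⟩
  ρ (true ∷ Z) ∎
  where
  open ≤-Reasoning
  Z = X ∩ B
  submodular-exchange : ρ (true ∷ B) + ρ (false ∷ Z) ≤ ρ (true ∷ Z) + ρ (false ∷ B)
  submodular-exchange =
    subst₂ (λ Z∪B Z∩B → ρ (true ∷ Z∪B) + ρ (false ∷ Z∩B) ≤ ρ (true ∷ Z) + ρ (false ∷ B))
           (p⊆q⇒p∪q≡q (p∩q⊆q X B)) (p⊆q⇒p∩q≡p (p∩q⊆q X B))
           (submodular pm (true ∷ Z) (false ∷ B))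

greedy-independent : ∀ {ρ : Subset n → ℕ} → IsIntPolymatroid ρ → ∀ B → Independent ρ (greedy ρ B)
greedy-independent pm B X = ≤-trans (greedy-bounded pm B X) (monotone pm _ _ (p∩q⊆p X B))

p⊆q∧x∈p⇒p∪[q-x]≡q : ∀ {p q : Subset n} {x} → p ⊆ q → x ∈ p → p ∪ (q - x) ≡ q
p⊆q∧x∈p⇒p∪[q-x]≡q {p = p} {q} {x} p⊆q x∈p = ⊆-antisym
  (λ y∈ → [ p⊆q , x∈p-y⇒x∈p q ]′ (x∈p∪q⁻ p (q - x) y∈))
  (λ {y} y∈q → case y ≟ x of λ
     { (yes refl) → x∈p∪q⁺ (inj₁ x∈p)
     ; (no y≢x)   → x∈p∪q⁺ (inj₂ (x∈p∧x≢y⇒x∈p-y y∈q y≢x)) })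

p⊆q⇒p∩[q-x]≡p-x : ∀ {p q : Subset n} {x} → p ⊆ q → p ∩ (q - x) ≡ p - x
p⊆q⇒p∩[q-x]≡p-x {p = p} {q} p⊆q = ⊆-antisym
  (λ y∈ → let y∈p , y∈q-x = x∈p∩q⁻ p _ y∈ in x∈p∧x≢y⇒x∈p-y y∈p (x∈p-y⇒x≢y q y∈q-x))
  (λ y∈ → let y∈p = x∈p-y⇒x∈p p y∈ in
          x∈p∩q⁺ (y∈p , x∈p∧x≢y⇒x∈p-y (p⊆q y∈p) (x∈p-y⇒x≢y p y∈)))

-- By submodularity ρ(A) ≤ ρ(A - i) + ρ({i}) always holds, so this says that the
-- inequality is an equality: {i} is a separator of ρ restricted to A.
IsSeparator : (Subset n → ℕ) → Subset n → Fin n → Set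
IsSeparator ρ A i = ρ (A - i) + ρ ⁅ i ⁆ ≤ ρ A

isSeparator-⊆ : ∀ {ρ : Subset n → ℕ} → IsIntPolymatroid ρ → ∀ {A Y i} →
                IsSeparator ρ A i → Y ⊆ A → i ∈ Y → IsSeparator ρ Y i
isSeparator-⊆ {ρ = ρ} pm {A} {Y} {i} sep Y⊆A i∈Y = +-cancelˡ-≤ (ρ (A - i)) _ _ (begin
  ρ (A - i) + (ρ (Y - i) + ρ ⁅ i ⁆)  ≡⟨ x∙yz≈y∙xz (ρ (A - i)) (ρ (Y - i)) (ρ ⁅ i ⁆) ⟩
  ρ (Y - i) + (ρ (A - i) + ρ ⁅ i ⁆)  ≤⟨ +-monoʳ-≤ (ρ (Y - i)) sep ⟩
  ρ (Y - i) + ρ A                    ≡⟨ +-comm (ρ (Y - i)) (ρ A) ⟩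
  ρ A + ρ (Y - i)                    ≤⟨ submodular-on-A ⟩
  ρ Y + ρ (A - i)                    ≡⟨ +-comm (ρ Y) (ρ (A - i)) ⟩
  ρ (A - i) + ρ Y                    ∎)
  where
  open ≤-Reasoning
  submodular-on-A : ρ A + ρ (Y - i) ≤ ρ Y + ρ (A - i)
  submodular-on-A = subst₂ (λ Y∪A-i Y∩A-i → ρ Y∪A-i + ρ Y∩A-i ≤ ρ Y + ρ (A - i))
                           (p⊆q∧x∈p⇒p∪[q-x]≡q Y⊆A i∈Y) (p⊆q⇒p∩[q-x]≡p-x Y⊆A)
                           (submodular pm Y (A - i))

independent-if-separator :
  ∀ {ρ : Subset n → ℕ} → IsIntPolymatroid ρ → ∀ {A i u} →
  i ∈ A → IsSeparator ρ A i → u i ≤ ρ ⁅ i ⁆ → (∀ j → j ∉ A → u j ≡ 0) →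
  Independent ρ (updateAt u i (const 0)) → Independent ρ u
independent-if-separator {ρ = ρ} pm {A} {i} {u} i∈A sep ui≤ supported ind₀ X with i ∈? X
... | no i∉X = subst (_≤ ρ X) (sum-updateAt-∉ u X i∉X) (ind₀ X)
... | yes i∈X = begin
  ∣ u ∣ₛ X                                       ≡⟨ sum-restrict X A supported ⟩
  ∣ u ∣ₛ Y                                       ≡⟨ sum-remove u Y i∈Y ⟩
  u i + ∣ u ∣ₛ (Y - i)                           ≡⟨ cong (u i +_) (sym (sum-updateAt-∉ u (Y - i) i∉Y-i)) ⟩
  u i + ∣ updateAt u i (const 0) ∣ₛ (Y - i)      ≤⟨ +-mono-≤ ui≤ (ind₀ (Y - i)) ⟩
  ρ ⁅ i ⁆ + ρ (Y - i)                            ≡⟨ +-comm (ρ ⁅ i ⁆) (ρ (Y - i)) ⟩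
  ρ (Y - i) + ρ ⁅ i ⁆                            ≤⟨ isSeparator-⊆ pm sep (p∩q⊆q X A) i∈Y ⟩
  ρ Y                                            ≤⟨ monotone pm Y X (p∩q⊆p X A) ⟩
  ρ X                                            ∎
  where
  open ≤-Reasoning
  Y = X ∩ A
  i∈Y : i ∈ Y
  i∈Y = x∈p∩q⁺ (i∈X , i∈A)
  i∉Y-i : i ∉ Y - i
  i∉Y-i i∈ = x∈p-y⇒x≢y Y i∈ refl

rank-deficit-of-circuit :
  ∀ {ρ : Subset n → ℕ} → IsIntPolymatroid ρ → ∀ {A i u} → i ∈ A →
  IsCircuit ρ u → 0 < u i → (∀ j → j ∉ A → u j ≡ 0) → ρ A < ρ (A - i) + ρ ⁅ i ⁆
rank-deficit-of-circuit {ρ = ρ} pm {A} {i} {u} i∈A (inBox , dep , minimal) 0<ui supported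
  with ρ A <? ρ (A - i) + ρ ⁅ i ⁆
... | yes deficit = deficit
... | no ≮ = contradiction
  (independent-if-separator pm i∈A (≮⇒≥ ≮) (inBox i) supported
     (minimal u₀ u₀≤u (λ u₀≡u → <-irrefl (trans (sym (updateAt-updates i u)) (u₀≡u i)) 0<ui)))
  dep
  where
  u₀ = updateAt u i (const 0)
  u₀≤u : u₀ ≤ᵥ u
  u₀≤u = updateAt-elim (λ j x → x ≤ u j) u i z≤n (λ _ _ → ≤-refl)

circuit-of-rank-deficit :
  ∀ {ρ : Subset n → ℕ} → IsIntPolymatroid ρ → ∀ {A i} → i ∈ A → ρ A < ρ (A - i) + ρ ⁅ i ⁆ →
  ∃ λ u → IsCircuit ρ u × 0 < u i × (∀ j → j ∉ A → u j ≡ 0)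
circuit-of-rank-deficit {ρ = ρ} pm {A} {i} i∈A deficit = u , (inBox , minDep) , 0<ui , supported
  where
  b = greedy ρ (A - i)
  b-independent : Independent ρ b
  b-independent = greedy-independent pm (A - i)
  v = updateAt b i (const (ρ ⁅ i ⁆))

  v-dependent : ¬ Independent ρ v
  v-dependent v-independent = <⇒≱ deficit (begin
    ρ (A - i) + ρ ⁅ i ⁆       ≡⟨ +-comm (ρ (A - i)) (ρ ⁅ i ⁆) ⟩
    ρ ⁅ i ⁆ + ρ (A - i)       ≡⟨ cong (ρ ⁅ i ⁆ +_) (sym (greedy-sum pm (A - i))) ⟩
    ρ ⁅ i ⁆ + ∣ b ∣ₛ (A - i)  ≡⟨ sym (sum-updateAt-∈ b A i∈A) ⟩
    ∣ v ∣ₛ A                  ≤⟨ v-independent A ⟩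
    ρ A                       ∎)
    where open ≤-Reasoning

  descent = dependent⇒minimallyDependent-below ρ v v-dependent
  u = proj₁ descent
  u≤v : u ≤ᵥ v
  u≤v = proj₁ (proj₂ descent)
  minDep : MinimallyDependent ρ u
  minDep = proj₂ (proj₂ descent)

  inBox : InBox ρ u
  inBox j = ≤-trans (u≤v j)
    (updateAt-elim (λ k x → x ≤ ρ ⁅ k ⁆) b i ≤-refl (λ k _ → independent⇒inBox b-independent k) j)

  u≤b : u i ≡ 0 → u ≤ᵥ b
  u≤b ui≡0 j = updateAt-elim (λ k x → u k ≤ x → u k ≤ b k) b i
    (λ _ → subst (_≤ b i) (sym ui≡0) z≤n) (λ _ _ uk≤bk → uk≤bk) j (u≤v j)

  0<ui : 0 < u i
  0<ui = n≢0⇒n>0 λ ui≡0 → proj₁ minDep (independent-antitone (u≤b ui≡0) b-independent)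

  supported : ∀ j → j ∉ A → u j ≡ 0
  supported j j∉A = n≤0⇒n≡0 (≤-trans (u≤v j) (≤-reflexive
    (updateAt-elim (λ k x → k ∉ A → x ≡ 0) b i (contradiction i∈A)
       (λ k _ k∉A → greedy-outside ρ (A - i) (k∉A ∘ x∈p-y⇒x∈p A)) j j∉A)))

lemma4p2 : ∀ {n} (ρ : Subset n → ℕ) → IsIntPolymatroid ρ →
    ∀ (A : Subset n) (i : Fin n) → i ∈ A →
    (ρ A < ρ (A - i) + ρ ⁅ i ⁆) ⇔
    Σ (Fin n → ℕ) (λ u → IsCircuit ρ u × 0 < u i × (∀ j → j ∉ A → u j ≡ 0))
lemma4p2 ρ pm A i i∈A = mk⇔
  (circuit-of-rank-deficit pm i∈A)
  (λ (u , circuit , 0<ui , supported) → rank-deficit-of-circuit pm i∈A circuit 0<ui supported)
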